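{- Let $A$, $B$, $C$ be finite $\sigma$-structures and $k\ge 1$; let $S$ be a flasque subpresheaf of $H_k(A,B)$ and $T$ a flasque subpresheaf of $H_k(B,C)$. Suppose $U_0 \in S_k(A)$, $s_0 \in S(U_0)$, $t_0 \in T(\operatorname{im} s_0)$, and that $\alpha$ is a global section of $\mathbb{Z}^{(S)}$ with $\alpha_{U_0} = 1\cdot s_0$ and $\beta$ is a global section of $\mathbb{Z}^{(T)}$ with $\beta_{\operatorname{im} s_0} = 1 \cdot t_0$. Then there is a global section $\alpha \ltimes \beta$ of $\mathbb{Z}^{(S \ltimes T)}$ with $(\alpha\ltimes\beta)_{U_0} = 1\cdot(s_0,t_0)$.
   Context: $\sigma$ is a finite relational vocabulary; structures are identified with universes. For structures $X, Y$, $S_k(X)$ is the poset of subsets of $X$ of size at most $k$ (induced substructures), and $H_k(X,Y) : S_k(X)^{op} \to \mathbf{Set}$ sends $D$ to the set of homomorphisms $D \to Y$, with restriction of functions as restriction maps. A subpresheaf is flasque if its restriction maps are surjective. Note $\operatorname{im} s \in S_k(B)$ for $s \in S(U)$. $S \ltimes T$ is the presheaf on $S_k(A)$ with $(S\ltimes T)(U) = \{(s,t) : s \in S(U),\ t \in T(\operatorname{im} s)\}$ and, for $U' \subseteq U$, restriction $(s,t) \mapsto (s|_{U'}, t|_{\operatorname{im}(s|_{U'})})$. For a set $X$, $\mathbb{Z}^{(X)}$ is the free abelian group on $X$, and for $f: X\to Y$, $\mathbb{Z}^{(f)}(\sum r_i x_i) = \sum r_i f(x_i)$; for a set-valued presheaf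 $P$, $\mathbb{Z}^{(P)}$ is the abelian-group-valued presheaf obtained by applying this functor pointwise. A global section of an abelian-group-valued presheaf $\mathcal{F}$ on a poset $S_k(X)$ is a family $\{x_D\}_{D}$, $x_D \in \mathcal{F}(D)$, compatible with all restriction maps. -}

module Defs where

open import Data.Nat using (ℕ; _≤_)
open import Data.Integer using (ℤ; 0ℤ; 1ℤ; _+_)
open import Data.Bool using (Bool; true; false; if_then_else_)
open import Data.Fin using (Fin)
open import Data.Fin.Subset using (Subset; _∈_; _∉_; _⊆_; ∣_∣; ⁅_⁆; _∪_) renaming (⊥ to ∅)
open import Data.Vec using (Vec; []; _∷_; lookup; map; zipWith)
open import Data.Maybe using (Maybe; just; nothing)
open import Data.List using (List; []; _∷_)
import Data.List as L
open import Data.List.Relation.Unary.All using (All)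
open import Data.Product using (Σ; ∃; _×_; _,_; proj₁; proj₂)
open import Relation.Nullary using (¬_; does)
open import Relation.Binary.PropositionalEquality using (_≡_)
open import Relation.Binary.Definitions using (DecidableEquality)
import Data.Vec.Properties as VP
import Data.Maybe.Properties as MP
import Data.Product.Properties as PP
import Data.Fin as F

record Vocabulary : Set where
  field
    nsym  : ℕ
    arity : Fin nsym → ℕ
open Vocabulary public

record Structure (σ : Vocabulary) : Set where
  field
    size : ℕ
    rel  : (R : Fin (nsym σ)) → Vec (Fin size) (arity σ R) → Bool
open Structure public

PMap : ℕ → ℕ → Set
PMap n m = Vec (Maybe (Fin m)) n

_≟PMap_ : ∀ {n m} → DecidableEquality (PMap n m)
_≟PMap_ = VP.≡-dec (MP.≡-dec F._≟_)

HasDomain : ∀ {n m} → Subset n → PMap n m → Set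
HasDomain D f = ∀ x → (x ∈ D → ∃ λ y → lookup f x ≡ just y)
                    × (x ∉ D → lookup f x ≡ nothing)

restrict : ∀ {n m} → Subset n → PMap n m → PMap n m
restrict U' f = zipWith (λ b v → if b then v else nothing) U' f

im : ∀ {n m} → PMap n m → Subset m
im []             = ∅
im (nothing ∷ f)  = im f
im (just y ∷ f)   = ⁅ y ⁆ ∪ im f

IsHom : ∀ {σ} (X Y : Structure σ) → Subset (size X) → PMap (size X) (size Y) → Set
IsHom {σ} X Y D f =
  HasDomain D f ×
  (∀ (R : Fin (nsym σ)) (xs : Vec (Fin (size X)) (arity σ R))
     (ys : Vec (Fin (size Y)) (arity σ R)) →
     map (lookup f) xs ≡ map just ys →      -- all xs lie in D, and f xs = ys
     rel X R xs ≡ true → rel Y R ys ≡ true)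

-- H_k(X,Y)(D) = { f | f : D → Y homomorphism }, for D ∈ S_k(X).
IsSubpresheafHk : ∀ {σ} (k : ℕ) (X Y : Structure σ) →
                  (Subset (size X) → PMap (size X) (size Y) → Set) → Set
IsSubpresheafHk k X Y S =
  (∀ D f → ∣ D ∣ ≤ k → S D f → IsHom X Y D f) ×
  (∀ D D' f → ∣ D ∣ ≤ k → D' ⊆ D → S D f → S D' (restrict D' f))

IsFlasque : ∀ {n m} (k : ℕ) → (Subset n → PMap n m → Set) → Set
IsFlasque k S =
  ∀ D D' g → ∣ D ∣ ≤ k → D' ⊆ D → S D' g →
  ∃ λ f → S D f × restrict D' f ≡ g

SemiProd : ∀ {n m p} → (Subset n → PMap n m → Set) → (Subset m → PMap m p → Set) →
           Subset n → PMap n m × PMap m p → Set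
SemiProd S T U (s , t) = S U s × T (im s) t

restrictSP : ∀ {n m p} → Subset n → PMap n m × PMap m p → PMap n m × PMap m p
restrictSP U' (s , t) = restrict U' s , restrict (im (restrict U' s)) t

_≟SP_ : ∀ {n m p} → DecidableEquality (PMap n m × PMap m p)
_≟SP_ = PP.≡-dec _≟PMap_ _≟PMap_

-- Free abelian groups ℤ^(X): formal sums (lists of coefficient/element
-- pairs) identified when they have the same coefficient function.

FormalSum : Set → Set
FormalSum X = List (ℤ × X)

coeff : ∀ {X : Set} → DecidableEquality X → FormalSum X → X → ℤ
coeff _≟_ []             x = 0ℤ
coeff _≟_ ((r , y) ∷ l)  x = (if does (y ≟ x) then r else 0ℤ) + coeff _≟_ l x

FSEq : ∀ {X : Set} → DecidableEquality X → FormalSum X → FormalSum X → Set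
FSEq {X} dec a b = ∀ (x : X) → coeff dec a x ≡ coeff dec b x

mapFS : ∀ {X Y : Set} → (X → Y) → FormalSum X → FormalSum Y
mapFS f = L.map (λ p → proj₁ p , f (proj₂ p))

unit : ∀ {X : Set} → X → FormalSum X
unit x = L.[ (1ℤ , x) ]

-- Global sections of ℤ^(P) for a set-valued presheaf P on S_k(Fin n),
-- P given by predicates P U on a type X with decidable equality and
-- restriction maps res U'.

IsGlobalSection : ∀ {X : Set} (dec : DecidableEquality X) (n k : ℕ)
                  (P : Subset n → X → Set) (res : Subset n → X → X)
                  (γ : Subset n → FormalSum X) → Set
IsGlobalSection dec n k P res γ =
  (∀ U → ∣ U ∣ ≤ k → All (λ p → P U (proj₂ p)) (γ U)) ×
  (∀ U U' → ∣ U ∣ ≤ k → U' ⊆ U → FSEq dec (mapFS (res U') (γ U)) (γ U'))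

-- The section α ⋉ β sends U to Σ_s α_U(s) · Σ_t β_{im s}(t) · (s , t): it is the image of α_U
-- under the Kleisli extension of the free abelian group monad along s ↦ (1·s) ⋉ β.
-- Compatibility with restriction reduces to that of α and of β, because im (s|U′) ⊆ im s and
-- |im s| ≤ |U| ≤ k; the value at U₀ is (1·s₀) ⋉ β = 1·(s₀ , t₀). Equalities in ℤ^(X) are
-- proved by pairing with ℤ-valued weights on X, which detects them: coefficients are pairings
-- with indicator weights, and conversely a pairing only depends on the coefficients.
module Submission where

open import Defs
open import Algebra.Bundles using (AbelianGroup)
open import Data.Nat using (ℕ; _≤_; _<_; s≤s; suc) renaming (_+_ to _+ᴺ_)
open import Data.Nat.Properties using (≤-refl; ≤-reflexive; ≤-trans; ≤-pred; +-mono-≤)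
open import Data.Integer using (ℤ; 0ℤ; 1ℤ; _+_; _*_)
open import Data.Integer.Properties
  using (+-0-abelianGroup; +-identityˡ; +-identityʳ; +-assoc; +-comm;
         *-identityˡ; *-identityʳ; *-zeroʳ; *-assoc; *-distribˡ-+; *-distribʳ-+)
open import Algebra.Properties.Group (AbelianGroup.group +-0-abelianGroup) using (∙-cancelˡ)
open import Data.Bool using (if_then_else_)
open import Data.Fin using (Fin; zero; suc)
open import Data.Fin.Subset using (Subset; _⊆_; ∣_∣; ⁅_⁆; _∪_; inside; outside)
open import Data.Fin.Subset.Properties using (∣⊥∣≡0; ∣p∣≤∣x∷p∣; ∪-identityˡ; p⊆p∪q; q⊆p∪q; x∈p∪q⁻)
open import Data.Vec using ([]; _∷_; here; there)
open import Data.Maybe using (just; nothing)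
open import Data.List using ([]; _∷_; _++_; length; filter)
import Data.List as List
open import Data.List.Properties using (map-∘; map-++; length-filter; filter-reject)
open import Data.List.Relation.Unary.All using (All; []; _∷_)
import Data.List.Relation.Unary.All as All
open import Data.List.Relation.Unary.All.Properties using (++⁺; map⁺)
open import Data.Product using (∃; _×_; _,_; proj₁; proj₂)
open import Data.Sum using (inj₁; inj₂)
open import Function using (_∘_)
open import Relation.Nullary using (does; yes; no; ¬?)
open import Relation.Binary.Bundles using (Setoid)
open import Relation.Binary.Definitions using (DecidableEquality)
open import Relation.Binary.PropositionalEquality
  using (_≡_; refl; sym; trans; cong; cong₂; module ≡-Reasoning)

∣⁅x⁆∪p∣≤1+∣p∣ : ∀ {n} (x : Fin n) (p : Subset n) → ∣ ⁅ x ⁆ ∪ p ∣ ≤ suc ∣ p ∣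
∣⁅x⁆∪p∣≤1+∣p∣ zero    (b ∷ p)       = s≤s (≤-trans (≤-reflexive (cong ∣_∣ (∪-identityˡ p))) (∣p∣≤∣x∷p∣ b p))
∣⁅x⁆∪p∣≤1+∣p∣ (suc x) (outside ∷ p) = ∣⁅x⁆∪p∣≤1+∣p∣ x p
∣⁅x⁆∪p∣≤1+∣p∣ (suc x) (inside ∷ p)  = s≤s (∣⁅x⁆∪p∣≤1+∣p∣ x p)

HasDomain-tail : ∀ {n m b v} {D : Subset n} {f : PMap n m} → HasDomain (b ∷ D) (v ∷ f) → HasDomain D f
HasDomain-tail h x =
  (λ x∈D → proj₁ (h (suc x)) (there x∈D)) , (λ x∉D → proj₂ (h (suc x)) λ { (there x∈D) → x∉D x∈D })

∣im∣≤∣dom∣ : ∀ {n m} (D : Subset n) (f : PMap n m) → HasDomain D f → ∣ im f ∣ ≤ ∣ D ∣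
∣im∣≤∣dom∣ {m = m} [] [] _ = ≤-reflexive (∣⊥∣≡0 m)
∣im∣≤∣dom∣ (inside ∷ D) (just y ∷ f) h =
  ≤-trans (∣⁅x⁆∪p∣≤1+∣p∣ y (im f)) (s≤s (∣im∣≤∣dom∣ D f (HasDomain-tail h)))
∣im∣≤∣dom∣ (outside ∷ D) (nothing ∷ f) h = ∣im∣≤∣dom∣ D f (HasDomain-tail h)
∣im∣≤∣dom∣ (inside ∷ D) (nothing ∷ f) h with proj₁ (h zero) here
... | _ , ()
∣im∣≤∣dom∣ (outside ∷ D) (just y ∷ f) h with proj₂ (h zero) (λ ())
... | ()

im-restrict-⊆ : ∀ {n m} (U : Subset n) (f : PMap n m) → im (restrict U f) ⊆ im f
im-restrict-⊆ []            []           y∈ = y∈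
im-restrict-⊆ (inside ∷ U)  (just y ∷ f) y∈ with x∈p∪q⁻ ⁅ y ⁆ (im (restrict U f)) y∈
... | inj₁ y∈⁅y⁆ = p⊆p∪q (im f) y∈⁅y⁆
... | inj₂ y∈im  = q⊆p∪q ⁅ y ⁆ (im f) (im-restrict-⊆ U f y∈im)
im-restrict-⊆ (outside ∷ U) (just y ∷ f) y∈ = q⊆p∪q ⁅ y ⁆ (im f) (im-restrict-⊆ U f y∈)
im-restrict-⊆ (inside ∷ U)  (nothing ∷ f) y∈ = im-restrict-⊆ U f y∈
im-restrict-⊆ (outside ∷ U) (nothing ∷ f) y∈ = im-restrict-⊆ U f y∈

SupportedIn : ∀ {X : Set} → (X → Set) → FormalSum X → Set
SupportedIn P = All (P ∘ proj₂)

eval : ∀ {X : Set} → (X → ℤ) → FormalSum X → ℤ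
eval w []            = 0ℤ
eval w ((r , x) ∷ l) = r * w x + eval w l

scale : ∀ {X : Set} → ℤ → FormalSum X → FormalSum X
scale r = List.map (λ p → r * proj₁ p , proj₂ p)

bind : ∀ {X Y : Set} → FormalSum X → (X → FormalSum Y) → FormalSum Y
bind []            g = []
bind ((r , x) ∷ l) g = scale r (g x) ++ bind l g

module _ {X : Set} where

  eval-unit : (w : X → ℤ) (x : X) → eval w (unit x) ≡ w x
  eval-unit w x = trans (+-identityʳ _) (*-identityˡ _)

  eval-++ : (w : X → ℤ) (a b : FormalSum X) → eval w (a ++ b) ≡ eval w a + eval w b
  eval-++ w []            b = sym (+-identityˡ _)
  eval-++ w ((r , x) ∷ a) b = trans (cong (r * w x +_) (eval-++ w a b)) (sym (+-assoc (r * w x) _ _))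

  eval-scale : (w : X → ℤ) (r : ℤ) (a : FormalSum X) → eval w (scale r a) ≡ r * eval w a
  eval-scale w r []            = sym (*-zeroʳ r)
  eval-scale w r ((q , x) ∷ a) =
    trans (cong₂ _+_ (*-assoc r q (w x)) (eval-scale w r a)) (sym (*-distribˡ-+ r (q * w x) (eval w a)))

  eval-cong-supported : ∀ {P : X → Set} {w w′ : X → ℤ} {a : FormalSum X} → SupportedIn P a →
                        (∀ x → P x → w x ≡ w′ x) → eval w a ≡ eval w′ a
  eval-cong-supported []               _  = refl
  eval-cong-supported (_∷_ {r , x} Px a) w≡w′ =
    cong₂ (λ u v → r * u + v) (w≡w′ x Px) (eval-cong-supported a w≡w′)

module _ {X Y : Set} where

  eval-mapFS : (w : Y → ℤ) (f : X → Y) (a : FormalSum X) → eval w (mapFS f a) ≡ eval (w ∘ f) a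
  eval-mapFS w f []            = refl
  eval-mapFS w f ((r , x) ∷ a) = cong (r * w (f x) +_) (eval-mapFS w f a)

  eval-bind : (w : Y → ℤ) (a : FormalSum X) (g : X → FormalSum Y) →
              eval w (bind a g) ≡ eval (λ x → eval w (g x)) a
  eval-bind w []            g = refl
  eval-bind w ((r , x) ∷ a) g =
    trans (eval-++ w (scale r (g x)) (bind a g)) (cong₂ _+_ (eval-scale w r (g x)) (eval-bind w a g))

  bind-mapFS : (f : X → Y) {Z : Set} (a : FormalSum X) (g : Y → FormalSum Z) →
               bind (mapFS f a) g ≡ bind a (g ∘ f)
  bind-mapFS f []            g = refl
  bind-mapFS f ((r , x) ∷ a) g = cong (scale r (g (f x)) ++_) (bind-mapFS f a g)

  mapFS-∘ : {Z : Set} (f : Y → Z) (g : X → Y) (a : FormalSum X) → mapFS f (mapFS g a) ≡ mapFS (f ∘ g) a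
  mapFS-∘ f g a = sym (map-∘ a)

  SupportedIn-mapFS : ∀ {P : X → Set} {Q : Y → Set} {f : X → Y} {a : FormalSum X} →
                      (∀ {x} → P x → Q (f x)) → SupportedIn P a → SupportedIn Q (mapFS f a)
  SupportedIn-mapFS P⇒Qf = map⁺ ∘ All.map P⇒Qf

  SupportedIn-bind : ∀ {P : X → Set} {Q : Y → Set} {g : X → FormalSum Y} {a : FormalSum X} →
                     (∀ x → P x → SupportedIn Q (g x)) → SupportedIn P a → SupportedIn Q (bind a g)
  SupportedIn-bind g-supp []                 = []
  SupportedIn-bind g-supp (_∷_ {r , x} Px a) = ++⁺ (map⁺ (g-supp x Px)) (SupportedIn-bind g-supp a)

mapFS-scale : ∀ {X Y : Set} (f : X → Y) (r : ℤ) (a : FormalSum X) → mapFS f (scale r a) ≡ scale r (mapFS f a)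
mapFS-scale f r a = trans (sym (map-∘ a)) (map-∘ a)

mapFS-bind : ∀ {X Y Z : Set} (f : Y → Z) (a : FormalSum X) (g : X → FormalSum Y) →
             mapFS f (bind a g) ≡ bind a (mapFS f ∘ g)
mapFS-bind f []            g = refl
mapFS-bind f ((r , x) ∷ a) g =
  trans (map-++ _ (scale r (g x)) (bind a g)) (cong₂ _++_ (mapFS-scale f r (g x)) (mapFS-bind f a g))

module _ {X : Set} (_≟_ : DecidableEquality X) where

  δ : X → X → ℤ
  δ x y = if does (y ≟ x) then 1ℤ else 0ℤ

  coeff≡eval-δ : (a : FormalSum X) (x : X) → coeff _≟_ a x ≡ eval (δ x) a
  coeff≡eval-δ []            x = refl
  coeff≡eval-δ ((r , y) ∷ a) x with y ≟ x
  ... | yes _ = cong₂ _+_ (sym (*-identityʳ r)) (coeff≡eval-δ a x)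
  ... | no _  = cong₂ _+_ (sym (*-zeroʳ r)) (coeff≡eval-δ a x)

  without : X → FormalSum X → FormalSum X
  without x = filter (λ p → ¬? (proj₂ p ≟ x))

  eval-split : (w : X → ℤ) (x : X) (a : FormalSum X) →
               eval w a ≡ coeff _≟_ a x * w x + eval w (without x a)
  eval-split w x []            = sym (+-identityˡ 0ℤ)
  eval-split w x ((r , y) ∷ a) with y ≟ x
  ... | yes refl = begin
    r * w y + eval w a        ≡⟨ cong (r * w y +_) (eval-split w x a) ⟩
    r * w y + (c * w y + e)   ≡⟨ sym (+-assoc (r * w y) _ _) ⟩
    r * w y + c * w y + e     ≡⟨ cong (_+ e) (sym (*-distribʳ-+ (w y) r c)) ⟩
    (r + c) * w y + e         ∎
    where
    open ≡-Reasoning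
    c = coeff _≟_ a x
    e = eval w (without x a)
  ... | no _ = begin
    r * w y + eval w a          ≡⟨ cong (r * w y +_) (eval-split w x a) ⟩
    r * w y + (c * w x + e)     ≡⟨ sym (+-assoc (r * w y) _ _) ⟩
    r * w y + c * w x + e       ≡⟨ cong (_+ e) (+-comm (r * w y) (c * w x)) ⟩
    c * w x + r * w y + e       ≡⟨ +-assoc (c * w x) _ _ ⟩
    c * w x + (r * w y + e)     ≡⟨ cong (λ z → z * w x + (r * w y + e)) (sym (+-identityˡ c)) ⟩
    (0ℤ + c) * w x + (r * w y + e) ∎
    where
    open ≡-Reasoning
    c = coeff _≟_ a x
    e = eval w (without x a)

  coeff-split : (x z : X) (a : FormalSum X) →
                coeff _≟_ a z ≡ coeff _≟_ a x * δ z x + coeff _≟_ (without x a) z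
  coeff-split x z a = begin
    coeff _≟_ a z                                        ≡⟨ coeff≡eval-δ a z ⟩
    eval (δ z) a                                         ≡⟨ eval-split (δ z) x a ⟩
    coeff _≟_ a x * δ z x + eval (δ z) (without x a)     ≡⟨ cong (coeff _≟_ a x * δ z x +_) (sym rest) ⟩
    coeff _≟_ a x * δ z x + coeff _≟_ (without x a) z    ∎
    where
    open ≡-Reasoning
    rest = coeff≡eval-δ (without x a) z

  without-cong : (x : X) (a b : FormalSum X) → FSEq _≟_ a b → FSEq _≟_ (without x a) (without x b)
  without-cong x a b a≈b z = ∙-cancelˡ (coeff _≟_ a x * δ z x) _ _ (begin
    coeff _≟_ a x * δ z x + coeff _≟_ (without x a) z   ≡⟨ sym (coeff-split x z a) ⟩
    coeff _≟_ a z                                       ≡⟨ a≈b z ⟩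
    coeff _≟_ b z                                       ≡⟨ coeff-split x z b ⟩
    coeff _≟_ b x * δ z x + coeff _≟_ (without x b) z   ≡⟨ cong (λ c → c * δ z x + _) (sym (a≈b x)) ⟩
    coeff _≟_ a x * δ z x + coeff _≟_ (without x b) z   ∎)
    where open ≡-Reasoning

  length-without-head : (r : ℤ) (x : X) (a : FormalSum X) →
                        length (without x ((r , x) ∷ a)) < length ((r , x) ∷ a)
  length-without-head r x a
    rewrite filter-reject (λ p → ¬? (proj₂ p ≟ x)) {r , x} {a} (λ x≢x → x≢x refl) =
    s≤s (length-filter _ a)

  eval≡-via-without : (x : X) (a b : FormalSum X) → FSEq _≟_ a b → (w : X → ℤ) →
                      eval w (without x a) ≡ eval w (without x b) → eval w a ≡ eval w b
  eval≡-via-without x a b a≈b w rest≡ = begin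
    eval w a                                      ≡⟨ eval-split w x a ⟩
    coeff _≟_ a x * w x + eval w (without x a)    ≡⟨ cong₂ (λ c e → c * w x + e) (a≈b x) rest≡ ⟩
    coeff _≟_ b x * w x + eval w (without x b)    ≡⟨ sym (eval-split w x b) ⟩
    eval w b                                      ∎
    where open ≡-Reasoning

  -- The bound n is only a termination measure: each step strips one point from both sums.
  FSEq⇒eval≡-bounded : (n : ℕ) (a b : FormalSum X) → length a +ᴺ length b ≤ n →
                        FSEq _≟_ a b → (w : X → ℤ) → eval w a ≡ eval w b
  FSEq⇒eval≡-bounded n [] [] _ _ w = refl
  FSEq⇒eval≡-bounded (suc n) a@((r , x) ∷ a′) b (s≤s bound) a≈b w =
    eval≡-via-without x a b a≈b w (FSEq⇒eval≡-bounded n (without x a) (without x b)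
      (≤-trans (+-mono-≤ (≤-pred (length-without-head r x a′)) (length-filter _ b)) bound)
      (without-cong x a b a≈b) w)
  FSEq⇒eval≡-bounded (suc n) [] b@((r , x) ∷ b′) (s≤s bound) a≈b w =
    eval≡-via-without x [] b a≈b w (FSEq⇒eval≡-bounded n [] (without x b)
      (≤-trans (≤-pred (length-without-head r x b′)) bound)
      (without-cong x [] b a≈b) w)

  FSEq⇒eval≡ : (a b : FormalSum X) → FSEq _≟_ a b → (w : X → ℤ) → eval w a ≡ eval w b
  FSEq⇒eval≡ a b = FSEq⇒eval≡-bounded _ a b ≤-refl

  eval≡⇒FSEq : (a b : FormalSum X) → ((w : X → ℤ) → eval w a ≡ eval w b) → FSEq _≟_ a b
  eval≡⇒FSEq a b eval≡ x = trans (coeff≡eval-δ a x) (trans (eval≡ (δ x)) (sym (coeff≡eval-δ b x)))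

  FSEq-setoid : Setoid _ _
  FSEq-setoid = record
    { Carrier       = FormalSum X
    ; _≈_           = FSEq _≟_
    ; isEquivalence = record
      { refl  = λ _ → refl
      ; sym   = λ a≈b x → sym (a≈b x)
      ; trans = λ a≈b b≈c x → trans (a≈b x) (b≈c x)
      }
    }

module _ {X Y : Set} (_≟X_ : DecidableEquality X) (_≟Y_ : DecidableEquality Y) where

  mapFS-cong : (f : X → Y) (a b : FormalSum X) → FSEq _≟X_ a b → FSEq _≟Y_ (mapFS f a) (mapFS f b)
  mapFS-cong f a b a≈b = eval≡⇒FSEq _≟Y_ (mapFS f a) (mapFS f b) λ w → begin
    eval w (mapFS f a)   ≡⟨ eval-mapFS w f a ⟩
    eval (w ∘ f) a       ≡⟨ FSEq⇒eval≡ _≟X_ a b a≈b (w ∘ f) ⟩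
    eval (w ∘ f) b       ≡⟨ sym (eval-mapFS w f b) ⟩
    eval w (mapFS f b)   ∎
    where open ≡-Reasoning

  bind-congˡ : (g : X → FormalSum Y) (a b : FormalSum X) → FSEq _≟X_ a b → FSEq _≟Y_ (bind a g) (bind b g)
  bind-congˡ g a b a≈b = eval≡⇒FSEq _≟Y_ (bind a g) (bind b g) λ w → begin
    eval w (bind a g)                ≡⟨ eval-bind w a g ⟩
    eval (λ x → eval w (g x)) a      ≡⟨ FSEq⇒eval≡ _≟X_ a b a≈b (λ x → eval w (g x)) ⟩
    eval (λ x → eval w (g x)) b      ≡⟨ sym (eval-bind w b g) ⟩
    eval w (bind b g)                ∎
    where open ≡-Reasoning

module _ {X Y : Set} (_≟_ : DecidableEquality Y) where

  bind-congʳ : ∀ {P : X → Set} {a : FormalSum X} (g h : X → FormalSum Y) → SupportedIn P a →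
               (∀ x → P x → FSEq _≟_ (g x) (h x)) → FSEq _≟_ (bind a g) (bind a h)
  bind-congʳ {a = a} g h a-supp g≈h = eval≡⇒FSEq _≟_ (bind a g) (bind a h) λ w → begin
    eval w (bind a g)                ≡⟨ eval-bind w a g ⟩
    eval (λ x → eval w (g x)) a      ≡⟨ eval-cong-supported a-supp (λ x Px → FSEq⇒eval≡ _≟_ (g x) (h x) (g≈h x Px) w) ⟩
    eval (λ x → eval w (h x)) a      ≡⟨ sym (eval-bind w a h) ⟩
    eval w (bind a h)                ∎
    where open ≡-Reasoning

  bind-unit : (x : X) (g : X → FormalSum Y) → FSEq _≟_ (bind (unit x) g) (g x)
  bind-unit x g = eval≡⇒FSEq _≟_ (bind (unit x) g) (g x) λ w →
    trans (eval-bind w (unit x) g) (eval-unit (λ y → eval w (g y)) x)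

Section : ℕ → ℕ → Set
Section n m = Subset n → FormalSum (PMap n m)

fibre : ∀ {n m p} → Section m p → PMap n m → FormalSum (PMap n m × PMap m p)
fibre β s = mapFS (s ,_) (β (im s))

_⋉_ : ∀ {n m p} → Section n m → Section m p → Subset n → FormalSum (PMap n m × PMap m p)
(α ⋉ β) U = bind (α U) (fibre β)

∣im∣≤k : ∀ {σ} {X Y : Structure σ} {k} {S : Subset (size X) → PMap (size X) (size Y) → Set} →
         IsSubpresheafHk k X Y S → ∀ {U s} → ∣ U ∣ ≤ k → S U s → ∣ im s ∣ ≤ k
∣im∣≤k (S⊆H , _) {U} {s} ∣U∣≤k Ss = ≤-trans (∣im∣≤∣dom∣ U s (proj₁ (S⊆H U s ∣U∣≤k Ss))) ∣U∣≤k

module _ {σ} {A B : Structure σ} {p k : ℕ}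
         {S : Subset (size A) → PMap (size A) (size B) → Set}
         {T : Subset (size B) → PMap (size B) p → Set}
         (S-sub : IsSubpresheafHk k A B S)
         {α : Section (size A) (size B)} {β : Section (size B) p}
         (α-sec : IsGlobalSection _≟PMap_ (size A) k S restrict α)
         (β-sec : IsGlobalSection _≟PMap_ (size B) k T restrict β)
         where

  ⋉-supported : ∀ U → ∣ U ∣ ≤ k → SupportedIn (SemiProd S T U) ((α ⋉ β) U)
  ⋉-supported U ∣U∣≤k = SupportedIn-bind fibre-supported (proj₁ α-sec U ∣U∣≤k)
    where
    fibre-supported : ∀ s → S U s → SupportedIn (SemiProd S T U) (fibre β s)
    fibre-supported s Ss = SupportedIn-mapFS (Ss ,_) (proj₁ β-sec (im s) (∣im∣≤k S-sub ∣U∣≤k Ss))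

  fibre-restrict : ∀ {U} U′ → ∣ U ∣ ≤ k → ∀ s → S U s →
                   FSEq _≟SP_ (mapFS (restrictSP U′) (fibre β s)) (fibre β (restrict U′ s))
  fibre-restrict U′ ∣U∣≤k s Ss = begin
    mapFS (restrictSP U′) (mapFS (s ,_) (β (im s)))   ≡⟨ mapFS-∘ (restrictSP U′) (s ,_) (β (im s)) ⟩
    mapFS ((s′ ,_) ∘ restrict (im s′)) (β (im s))     ≡⟨ sym (mapFS-∘ (s′ ,_) (restrict (im s′)) (β (im s))) ⟩
    mapFS (s′ ,_) β|                                  ≈⟨ mapFS-cong _≟PMap_ _≟SP_ (s′ ,_) β| (β (im s′)) β-restricts ⟩
    mapFS (s′ ,_) (β (im s′))                         ∎
    where
    open import Relation.Binary.Reasoning.Setoid (FSEq-setoid _≟SP_)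
    s′ = restrict U′ s
    β| = mapFS (restrict (im s′)) (β (im s))
    β-restricts : FSEq _≟PMap_ β| (β (im s′))
    β-restricts = proj₂ β-sec (im s) (im s′) (∣im∣≤k S-sub ∣U∣≤k Ss) (im-restrict-⊆ U′ s)

  ⋉-restrict : ∀ U U′ → ∣ U ∣ ≤ k → U′ ⊆ U → FSEq _≟SP_ (mapFS (restrictSP U′) ((α ⋉ β) U)) ((α ⋉ β) U′)
  ⋉-restrict U U′ ∣U∣≤k U′⊆U = begin
    mapFS (restrictSP U′) (bind (α U) (fibre β))   ≡⟨ mapFS-bind (restrictSP U′) (α U) (fibre β) ⟩
    bind (α U) (mapFS (restrictSP U′) ∘ fibre β)   ≈⟨ bind-congʳ _≟SP_ _ _ (proj₁ α-sec U ∣U∣≤k) (fibre-restrict U′ ∣U∣≤k) ⟩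
    bind (α U) (fibre β ∘ restrict U′)             ≡⟨ sym (bind-mapFS (restrict U′) (α U) (fibre β)) ⟩
    bind α| (fibre β)                              ≈⟨ bind-congˡ _≟PMap_ _≟SP_ (fibre β) α| (α U′) α-restricts ⟩
    bind (α U′) (fibre β)                          ∎
    where
    open import Relation.Binary.Reasoning.Setoid (FSEq-setoid _≟SP_)
    α| = mapFS (restrict U′) (α U)
    α-restricts : FSEq _≟PMap_ α| (α U′)
    α-restricts = proj₂ α-sec U U′ ∣U∣≤k U′⊆U

  ⋉-isGlobalSection : IsGlobalSection _≟SP_ (size A) k (SemiProd S T) restrictSP (α ⋉ β)
  ⋉-isGlobalSection = ⋉-supported , ⋉-restrict

⋉-unit : ∀ {n m p} (α : Section n m) (β : Section m p) U₀ s₀ t₀ →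
         FSEq _≟PMap_ (α U₀) (unit s₀) → FSEq _≟PMap_ (β (im s₀)) (unit t₀) →
         FSEq _≟SP_ ((α ⋉ β) U₀) (unit (s₀ , t₀))
⋉-unit α β U₀ s₀ t₀ α-U₀ β-s₀ = begin
  bind (α U₀) (fibre β)                 ≈⟨ bind-congˡ _≟PMap_ _≟SP_ (fibre β) (α U₀) (unit s₀) α-U₀ ⟩
  bind (unit s₀) (fibre β)              ≈⟨ bind-unit _≟SP_ s₀ (fibre β) ⟩
  mapFS (s₀ ,_) (β (im s₀))             ≈⟨ mapFS-cong _≟PMap_ _≟SP_ (s₀ ,_) (β (im s₀)) (unit t₀) β-s₀ ⟩
  unit (s₀ , t₀)                        ∎
  where open import Relation.Binary.Reasoning.Setoid (FSEq-setoid _≟SP_)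

proposition10p2 : ∀ {σ : Vocabulary} (A B C : Structure σ) (k : ℕ) → 1 ≤ k →
    (S : Subset (size A) → PMap (size A) (size B) → Set) →
    (T : Subset (size B) → PMap (size B) (size C) → Set) →
    IsSubpresheafHk k A B S → IsFlasque k S →
    IsSubpresheafHk k B C T → IsFlasque k T →
    (U₀ : Subset (size A)) → ∣ U₀ ∣ ≤ k →
    (s₀ : PMap (size A) (size B)) → S U₀ s₀ →
    (t₀ : PMap (size B) (size C)) → T (im s₀) t₀ →
    (α : Subset (size A) → FormalSum (PMap (size A) (size B))) →
    IsGlobalSection _≟PMap_ (size A) k S restrict α →
    FSEq _≟PMap_ (α U₀) (unit s₀) →
    (β : Subset (size B) → FormalSum (PMap (size B) (size C))) →
    IsGlobalSection _≟PMap_ (size B) k T restrict β →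
    FSEq _≟PMap_ (β (im s₀)) (unit t₀) →
    ∃ λ (γ : Subset (size A) → FormalSum (PMap (size A) (size B) × PMap (size B) (size C))) →
      IsGlobalSection _≟SP_ (size A) k (SemiProd S T) restrictSP γ
      × FSEq _≟SP_ (γ U₀) (unit (s₀ , t₀))
proposition10p2 A B C k _ S T S-sub _ _ _ U₀ _ s₀ _ t₀ _ α α-sec α-U₀ β β-sec β-s₀ =
  α ⋉ β , ⋉-isGlobalSection {T = T} S-sub α-sec β-sec , ⋉-unit α β U₀ s₀ t₀ α-U₀ β-s₀
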